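{- Let $G$ be a finite group (not necessarily abelian) of order $n$ and let $A_1,\dots,A_m$ be pairwise disjoint subsets of $G$ with sizes $k_1,\dots,k_m$ such that (i) the $A_i$ partition $G^*$, and (ii) every $A_i$ with $|A_i|>1$ has the form $A_i=S_i\setminus\{e\}$ for some subgroup $S_i$ of $G$. Then $\{A_1,\dots,A_m\}$ is a bimodal $(n,m;k_1,\dots,k_m;m-1)$-RWEDF.
   Context: Write $G$ multiplicatively with identity $e$ and $G^*=G\setminus\{e\}$. For $\delta\in G^*$, $N_j(\delta)=|\{(a,b): a\in A_j,\ b\in A_i \text{ for some } i\neq j,\ ab^{ -1}=\delta\}|$. The collection is bimodal if $N_j(\delta)\in\{0,k_j\}$ for all $\delta\in G^*$ and all $j$. An $(n,m;k_1,\dots,k_m;\ell)$-RWEDF is a collection of pairwise disjoint subsets with $|A_i|=k_i$ such that $\sum_i \frac{1}{k_i}N_i(\delta)=\ell$ for all $\delta\in G^*$. -}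

module Defs where

open import Data.Nat using (ℕ; zero; suc; _<_)
open import Data.Fin using (Fin)
open import Data.Fin.Properties using (any?; _≟_)
open import Data.Fin.Subset using (Subset; _∈_; _∉_; ∣_∣; _-_)
open import Data.Fin.Subset.Properties using (_∈?_)
open import Data.List using (List; map; allFin)
open import Data.Nat.ListAction using (sum)
open import Data.Bool using (Bool; true; false; _∧_)
open import Data.Product using (Σ; _×_; ∃-syntax)
open import Data.Sum using (_⊎_)
open import Data.Integer using (+_)
open import Data.Rational using (ℚ; 0ℚ; _/_) renaming (_+_ to _+ℚ_)
open import Relation.Nullary using (¬_; Dec; yes; no; ¬?; ⌊_⌋)
open import Relation.Nullary.Decidable using (_×-dec_)
open import Relation.Binary.PropositionalEquality using (_≡_; _≢_)

-- a / k as a rational (only used with k ≥ 1; the k = 0 case is a dummy value)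
frac : ℕ → ℕ → ℚ
frac a zero    = 0ℚ
frac a (suc k) = (+ a) / suc k

sumFinℚ : {m : ℕ} → (Fin m → ℚ) → ℚ
sumFinℚ {zero}  f = 0ℚ
sumFinℚ {suc m} f = f Fin.zero +ℚ sumFinℚ (λ i → f (Fin.suc i))

record FinGroup (n : ℕ) : Set where
  infixl 7 _·_
  field
    _·_ : Fin n → Fin n → Fin n
    e   : Fin n
    inv : Fin n → Fin n
    assoc    : ∀ x y z → (x · y) · z ≡ x · (y · z)
    identityˡ : ∀ x → e · x ≡ x
    identityʳ : ∀ x → x · e ≡ x
    inverseˡ : ∀ x → inv x · x ≡ e
    inverseʳ : ∀ x → x · inv x ≡ e

module _ {n : ℕ} (G : FinGroup n) where
  open FinGroup G

  IsSubgroup : Subset n → Set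
  IsSubgroup S = (e ∈ S)
               × (∀ x y → x ∈ S → y ∈ S → x · y ∈ S)
               × (∀ x → x ∈ S → inv x ∈ S)

  module _ {m : ℕ} (A : Fin m → Subset n) where

    pairInd : Fin m → Fin n → Fin n → Fin n → ℕ
    pairInd j δ a b with ⌊ a ∈? A j ⌋ ∧ ⌊ any? (λ i → ¬? (i ≟ j) ×-dec (b ∈? A i)) ⌋ ∧ ⌊ a · inv b ≟ δ ⌋
    ... | true  = 1
    ... | false = 0

    -- N_j(δ) = |{(a,b) : a ∈ A_j, b ∈ A_i for some i ≠ j, a b⁻¹ = δ}|
    N : Fin m → Fin n → ℕ
    N j δ = sum (map (λ a → sum (map (λ b → pairInd j δ a b) (allFin n))) (allFin n))

    PairwiseDisjoint : Set
    PairwiseDisjoint = ∀ i j x → i ≢ j → x ∈ A i → x ∉ A j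

    Bimodal : Set
    Bimodal = ∀ (δ : Fin n) → δ ≢ e → ∀ j → (N j δ ≡ 0) ⊎ (N j δ ≡ ∣ A j ∣)

    -- (n,m;k_1,…,k_m;ℓ)-RWEDF: pairwise disjoint, |A_i| = k_i (k_i ≥ 1 so 1/k_i
    -- makes sense), and Σ_i N_i(δ)/k_i = ℓ for all δ ∈ G*.
    IsRWEDF : (Fin m → ℕ) → ℚ → Set
    IsRWEDF k ℓ = PairwiseDisjoint
                × (∀ i → ∣ A i ∣ ≡ k i)
                × (∀ i → 0 < k i)
                × (∀ (δ : Fin n) → δ ≢ e → sumFinℚ (λ i → frac (N i δ) (k i)) ≡ ℓ)

-- Fix δ ≠ e and a block A_j.  In a pair (a, b) counted by N_j(δ) the element b
-- is determined by a, because a b⁻¹ = δ forces b = δ⁻¹ a.  Hence N_j(δ) counts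
-- the a ∈ A_j whose partner δ⁻¹ a lies in a block other than A_j.  Call a set X
-- quotient closed if x y⁻¹ and x⁻¹ y lie in X whenever x, y ∈ X and the quotient
-- is not e; singletons and punctured subgroups S ∖ {e} are quotient closed.
-- For a quotient-closed block A_j and a ∈ A_j, the partner δ⁻¹ a lies in
-- A_j ∪ {e} exactly when δ ∈ A_j.  As the blocks partition G*, this gives
-- N_j(δ) = 0 if δ ∈ A_j and N_j(δ) = |A_j| otherwise, which is bimodality.
-- Since δ lies in exactly one block, Σ_i N_i(δ)/|A_i| has one term 0 and
-- m − 1 terms 1, which is the RWEDF condition with ℓ = m − 1.
module Submission where

open import Defs
open import Level using (0ℓ)
open import Algebra.Bundles using (Group)
open import Data.Nat using (ℕ; zero; suc; _+_; _≤_; _<_; _<?_)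
import Data.Nat.Properties as ℕP
open import Data.Nat.Coprimality using (1-coprimeTo) renaming (sym to coprime-sym)
open import Data.Nat.ListAction using (sum)
open import Data.Integer using (+_)
import Data.Integer as ℤ
import Data.Integer.Properties as ℤP
open import Data.Rational using (ℚ; mkℚ; 0ℚ; 1ℚ; _-_; _/_) renaming (_+_ to _+ℚ_)
import Data.Rational.Properties as ℚP
open import Data.Rational.Unnormalised using (mkℚᵘ; *≡*)
open import Data.Fin using (Fin; punchIn) renaming (zero to fzero; suc to fsuc)
open import Data.Fin.Properties using (any?; _≟_; suc-injective; punchInᵢ≢i)
open import Data.Fin.Subset using (Subset; inside; outside; ⁅_⁆; _∈_; _∉_; ∣_∣) renaming (_-_ to _∖_)
open import Data.Fin.Subset.Properties
  using (_∈?_; drop-there; x∈⁅y⁆⇒x≡y; ∣⁅x⁆∣≡1; p⊆q⇒∣p∣≤∣q∣;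
         p─q⊆p; x∈p∧x≢y⇒x∈p-y; x∈p⇒∣p-x∣<∣p∣)
open import Data.Vec.Base using ([]; _∷_; here; there)
open import Data.List using (allFin; map; tabulate)
open import Data.List.Properties using (map-tabulate)
open import Data.Product using (_×_; _,_; proj₁; proj₂; ∃-syntax)
open import Data.Sum using (inj₁; inj₂)
open import Function using (_∘_)
open import Relation.Nullary using (¬_; yes; no; ¬?; contradiction)
open import Relation.Nullary.Decidable using (_×-dec_)
open import Relation.Binary.PropositionalEquality
  using (_≡_; _≢_; refl; sym; trans; cong; cong₂; subst; isEquivalence; module ≡-Reasoning)
open import Algebra.Properties.AbelianGroup ℚP.+-0-abelianGroup using (xyx⁻¹≈y)
open import Algebra.Properties.CommutativeMonoid.Sum ℕP.+-0-commutativeMonoid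
  using (sum-cong-≗; sum-replicate-zero; sum-remove) renaming (sum to ∑)

fromℕ : ℕ → ℚ
fromℕ k = (+ k) / 1

fromℕ-suc : ∀ k → 1ℚ +ℚ fromℕ k ≡ fromℕ (suc k)
fromℕ-suc k = begin
  1ℚ +ℚ fromℕ k     ≡⟨ cong (1ℚ +ℚ_) (ℚP.↥p/↧p≡p k/1) ⟩
  1ℚ +ℚ k/1         ≡⟨ cong (λ z → (+ 1 ℤ.+ z) / 1) (ℤP.*-identityʳ (+ k)) ⟩
  fromℕ (suc k)     ∎
  where
  open ≡-Reasoning
  k/1 : ℚ
  k/1 = mkℚ (+ k) 0 (coprime-sym (1-coprimeTo k))

fromℕ-pred : ∀ k → fromℕ k ≡ fromℕ (suc k) - 1ℚ
fromℕ-pred k = trans (sym (xyx⁻¹≈y 1ℚ (fromℕ k))) (cong (_- 1ℚ) (fromℕ-suc k))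

frac-zero : ∀ k → frac 0 k ≡ 0ℚ
frac-zero zero    = refl
frac-zero (suc k) = ℚP.0/n≡0 (suc k)

-- Both sides are fromℚᵘ of k/k and 1/1, which are equivalent fractions.
frac-self : ∀ k → 0 < k → frac k k ≡ 1ℚ
frac-self (suc k) _ =
  ℚP.fromℚᵘ-cong {mkℚᵘ (+ suc k) k} {mkℚᵘ (+ 1) 0} (*≡* (ℤP.*-comm (+ suc k) (+ 1)))

sumFinℚ-ones : ∀ {m} (g : Fin m → ℚ) → (∀ i → g i ≡ 1ℚ) → sumFinℚ g ≡ fromℕ m
sumFinℚ-ones {zero}  g ones = refl
sumFinℚ-ones {suc m} g ones =
  trans (cong₂ _+ℚ_ (ones fzero) (sumFinℚ-ones (g ∘ fsuc) (ones ∘ fsuc))) (fromℕ-suc m)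

sumFinℚ-ones-but-one : ∀ {m} (g : Fin m → ℚ) (i₀ : Fin m) → g i₀ ≡ 0ℚ
                     → (∀ i → i ≢ i₀ → g i ≡ 1ℚ) → sumFinℚ g ≡ fromℕ m - 1ℚ
sumFinℚ-ones-but-one {suc m} g fzero zero-at ones = begin
  g fzero +ℚ sumFinℚ (g ∘ fsuc)  ≡⟨ cong (_+ℚ sumFinℚ (g ∘ fsuc)) zero-at ⟩
  0ℚ +ℚ sumFinℚ (g ∘ fsuc)       ≡⟨ ℚP.+-identityˡ _ ⟩
  sumFinℚ (g ∘ fsuc)             ≡⟨ sumFinℚ-ones (g ∘ fsuc) (λ i → ones (fsuc i) λ ()) ⟩
  fromℕ m                        ≡⟨ fromℕ-pred m ⟩
  fromℕ (suc m) - 1ℚ             ∎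
  where open ≡-Reasoning
sumFinℚ-ones-but-one {suc m} g (fsuc i₀) zero-at ones = begin
  g fzero +ℚ sumFinℚ (g ∘ fsuc)  ≡⟨ cong₂ _+ℚ_ (ones fzero λ ()) rest ⟩
  1ℚ +ℚ (fromℕ m - 1ℚ)           ≡⟨ ℚP.+-assoc 1ℚ (fromℕ m) _ ⟨
  (1ℚ +ℚ fromℕ m) - 1ℚ           ≡⟨ cong (_- 1ℚ) (fromℕ-suc m) ⟩
  fromℕ (suc m) - 1ℚ             ∎
  where
  open ≡-Reasoning
  rest : sumFinℚ (g ∘ fsuc) ≡ fromℕ m - 1ℚ
  rest = sumFinℚ-ones-but-one (g ∘ fsuc) i₀ zero-at
           (λ i i≢i₀ → ones (fsuc i) (i≢i₀ ∘ suc-injective))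

sum-tabulate : ∀ {n} (f : Fin n → ℕ) → sum (tabulate f) ≡ ∑ f
sum-tabulate {zero}  f = refl
sum-tabulate {suc n} f = cong (_+_ (f fzero)) (sum-tabulate (f ∘ fsuc))

sum-map-allFin : ∀ {n} (f : Fin n → ℕ) → sum (map f (allFin n)) ≡ ∑ f
sum-map-allFin f = trans (cong sum (map-tabulate (λ i → i) f)) (sum-tabulate f)

∑-zero : ∀ {n} (f : Fin n → ℕ) → (∀ i → f i ≡ 0) → ∑ f ≡ 0
∑-zero {n} f zeros = trans (sum-cong-≗ zeros) (sum-replicate-zero n)

∑-single : ∀ {n} (f : Fin n → ℕ) (i₀ : Fin n) → (∀ i → i ≢ i₀ → f i ≡ 0) → ∑ f ≡ f i₀
∑-single {suc n} f i₀ zeros = begin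
  ∑ f                        ≡⟨ sum-remove {i = i₀} f ⟩
  f i₀ + ∑ (f ∘ punchIn i₀)  ≡⟨ cong (_+_ (f i₀)) (∑-zero _ λ i → zeros _ (punchInᵢ≢i i₀ i)) ⟩
  f i₀ + 0                   ≡⟨ ℕP.+-identityʳ (f i₀) ⟩
  f i₀                       ∎
  where open ≡-Reasoning

∑-indicator : ∀ {n} (p : Subset n) (f : Fin n → ℕ)
            → (∀ x → x ∈ p → f x ≡ 1) → (∀ x → x ∉ p → f x ≡ 0) → ∑ f ≡ ∣ p ∣
∑-indicator []            f ones zeros = refl
∑-indicator (inside ∷ p)  f ones zeros =
  cong₂ _+_ (ones fzero here)
    (∑-indicator p (f ∘ fsuc) (λ x x∈p → ones (fsuc x) (there x∈p))
                              (λ x x∉p → zeros (fsuc x) (x∉p ∘ drop-there)))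
∑-indicator (outside ∷ p) f ones zeros =
  cong₂ _+_ (zeros fzero λ ())
    (∑-indicator p (f ∘ fsuc) (λ x x∈p → ones (fsuc x) (there x∈p))
                              (λ x x∉p → zeros (fsuc x) (x∉p ∘ drop-there)))

∈⇒nonempty : ∀ {n} {p : Subset n} {x} → x ∈ p → 0 < ∣ p ∣
∈⇒nonempty {p = p} {x} x∈p =
  subst (_≤ ∣ p ∣) (∣⁅x⁆∣≡1 x)
    (p⊆q⇒∣p∣≤∣q∣ λ y∈⁅x⁆ → subst (_∈ p) (sym (x∈⁅y⁆⇒x≡y x y∈⁅x⁆)) x∈p)

∣p∣≤1⇒unique : ∀ {n} {p : Subset n} {x y} → ∣ p ∣ ≤ 1 → x ∈ p → y ∈ p → x ≡ y
∣p∣≤1⇒unique {p = p} {x} {y} ∣p∣≤1 x∈p y∈p with x ≟ y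
... | yes x≡y = x≡y
... | no  x≢y = contradiction ∣p∣≤1 (ℕP.<⇒≱ two-members)
  where
  -- y remains in p − x, which is strictly smaller than p
  two-members : 1 < ∣ p ∣
  two-members = ℕP.≤-<-trans (∈⇒nonempty (x∈p∧x≢y⇒x∈p-y y∈p (x≢y ∘ sym))) (x∈p⇒∣p-x∣<∣p∣ x∈p)

module Quotients {n : ℕ} (G : FinGroup n) where
  open FinGroup G

  -- G viewed as a group of the algebra library, to reuse its derived laws.
  asGroup : Group 0ℓ 0ℓ
  asGroup = record
    { _≈_ = _≡_ ; _∙_ = _·_ ; ε = e ; _⁻¹ = inv
    ; isGroup = record
      { isMonoid = record
        { isSemigroup = record
          { isMagma = record { isEquivalence = isEquivalence ; ∙-cong = cong₂ _·_ }
          ; assoc = assoc }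
        ; identity = identityˡ , identityʳ }
      ; inverse = inverseˡ , inverseʳ
      ; ⁻¹-cong = cong inv } }

  open import Algebra.Properties.Group asGroup
    using (\\-leftDividesˡ; \\-leftDividesʳ; //-rightDividesˡ; ⁻¹-anti-homo-\\)
  open ≡-Reasoning

  partner-quotient : ∀ δ a → a · inv (inv δ · a) ≡ δ
  partner-quotient δ a = begin
    a · inv (inv δ · a) ≡⟨ cong (a ·_) (⁻¹-anti-homo-\\ δ a) ⟩
    a · (inv a · δ)     ≡⟨ \\-leftDividesˡ a δ ⟩
    δ                   ∎

  partner-unique : ∀ δ a b → a · inv b ≡ δ → b ≡ inv δ · a
  partner-unique δ a b a/b≡δ = begin
    b                       ≡⟨ \\-leftDividesʳ δ b ⟨
    inv δ · (δ · b)         ≡⟨ cong (λ z → inv δ · (z · b)) a/b≡δ ⟨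
    inv δ · (a · inv b · b) ≡⟨ cong (inv δ ·_) (//-rightDividesˡ b a) ⟩
    inv δ · a               ∎

  partner-e : ∀ δ a → inv δ · a ≡ e → a ≡ δ
  partner-e δ a δ\\a≡e = begin
    a               ≡⟨ \\-leftDividesˡ δ a ⟨
    δ · (inv δ · a) ≡⟨ cong (δ ·_) δ\\a≡e ⟩
    δ · e           ≡⟨ identityʳ δ ⟩
    δ               ∎

module _ {n : ℕ} (G : FinGroup n) where
  open FinGroup G

  QuotientClosed : Subset n → Set
  QuotientClosed X = (∀ x y → x ∈ X → y ∈ X → x · inv y ≢ e → x · inv y ∈ X)
                   × (∀ x y → x ∈ X → y ∈ X → inv x · y ≢ e → inv x · y ∈ X)

  -- In a set with at most one element every quotient is e.
  small⇒quotientClosed : ∀ {X} → ∣ X ∣ ≤ 1 → QuotientClosed X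
  small⇒quotientClosed {X} ∣X∣≤1 =
    (λ x y x∈X y∈X x/y≢e →
       contradiction (trans (cong (λ z → x · inv z) (unique y∈X x∈X)) (inverseʳ x)) x/y≢e) ,
    (λ x y x∈X y∈X x\\y≢e →
       contradiction (trans (cong (inv x ·_) (unique y∈X x∈X)) (inverseˡ x)) x\\y≢e)
    where
    unique : ∀ {x y} → x ∈ X → y ∈ X → x ≡ y
    unique = ∣p∣≤1⇒unique ∣X∣≤1

  punctured⇒quotientClosed : ∀ {S} → IsSubgroup G S → QuotientClosed (S ∖ e)
  punctured⇒quotientClosed {S} (_ , ·-closed , inv-closed) =
    (λ x y x∈ y∈ ≢e → x∈p∧x≢y⇒x∈p-y (·-closed x (inv y) (inS x∈) (inv-closed y (inS y∈))) ≢e) ,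
    (λ x y x∈ y∈ ≢e → x∈p∧x≢y⇒x∈p-y (·-closed (inv x) y (inv-closed x (inS x∈)) (inS y∈)) ≢e)
    where
    inS : ∀ {x} → x ∈ S ∖ e → x ∈ S
    inS = p─q⊆p S ⁅ e ⁆

  block⇒quotientClosed : ∀ {X} → (1 < ∣ X ∣ → ∃[ S ] (IsSubgroup G S × X ≡ S ∖ e))
                       → QuotientClosed X
  block⇒quotientClosed {X} block with 1 <? ∣ X ∣
  ... | no  ¬1<∣X∣ = small⇒quotientClosed (ℕP.≮⇒≥ ¬1<∣X∣)
  ... | yes 1<∣X∣ with block 1<∣X∣
  ...   | S , subgroup , refl = punctured⇒quotientClosed subgroup

module BlockCounts {n m : ℕ} (G : FinGroup n) (A : Fin m → Subset n)
  (disjoint : PairwiseDisjoint G A)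
  (avoid-e  : ∀ i x → x ∈ A i → x ≢ FinGroup.e G)
  (cover    : ∀ x → x ≢ FinGroup.e G → ∃[ i ] (x ∈ A i))
  (closed   : ∀ i → QuotientClosed G (A i)) where

  open FinGroup G
  open Quotients G

  InOtherBlock : Fin m → Fin n → Set
  InOtherBlock j b = ∃[ i ] (i ≢ j × b ∈ A i)

  pairInd-present : ∀ j δ a b → a ∈ A j → InOtherBlock j b → a · inv b ≡ δ
                  → pairInd G A j δ a b ≡ 1
  pairInd-present j δ a b a∈ other quotient
    with a ∈? A j | any? (λ i → ¬? (i ≟ j) ×-dec (b ∈? A i)) | a · inv b ≟ δ
  ... | yes _  | yes _      | yes _ = refl
  ... | no  a∉ | _          | _     = contradiction a∈ a∉
  ... | yes _  | no  ¬other | _     = contradiction other ¬other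
  ... | yes _  | yes _      | no ≢δ = contradiction quotient ≢δ

  pairInd-absent : ∀ j δ a b → ¬ (a ∈ A j × InOtherBlock j b × a · inv b ≡ δ)
                 → pairInd G A j δ a b ≡ 0
  pairInd-absent j δ a b not-counted
    with a ∈? A j | any? (λ i → ¬? (i ≟ j) ×-dec (b ∈? A i)) | a · inv b ≟ δ
  ... | yes a∈ | yes other | yes quotient = contradiction (a∈ , other , quotient) not-counted
  ... | no  _  | _         | _            = refl
  ... | yes _  | no  _     | _            = refl
  ... | yes _  | yes _     | no  _        = refl

  N-by-partner : ∀ j δ → N G A j δ ≡ ∑ (λ a → pairInd G A j δ a (inv δ · a))
  N-by-partner j δ = trans (sum-map-allFin {n} _) (sum-cong-≗ λ a →
    trans (sum-map-allFin {n} _) (∑-single _ (inv δ · a) λ b b≢ →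
      pairInd-absent j δ a b λ (_ , _ , quotient) → b≢ (partner-unique δ a b quotient)))

  partner-stays : ∀ j δ a → δ ∈ A j → a ∈ A j → ¬ InOtherBlock j (inv δ · a)
  partner-stays j δ a δ∈ a∈ (i , i≢j , partner∈) with inv δ · a ≟ e
  ... | yes partner≡e = avoid-e i _ partner∈ partner≡e
  ... | no  partner≢e = disjoint i j _ i≢j partner∈ (proj₂ (closed j) δ a δ∈ a∈ partner≢e)

  partner-leaves : ∀ j δ a → δ ≢ e → δ ∉ A j → a ∈ A j → InOtherBlock j (inv δ · a)
  partner-leaves j δ a δ≢e δ∉ a∈ = elsewhere (cover b b≢e)
    where
    b : Fin n
    b = inv δ · a
    b≢e : b ≢ e
    b≢e b≡e = δ∉ (subst (_∈ A j) (partner-e δ a b≡e) a∈)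
    -- otherwise δ = a b⁻¹ would be a quotient of members of A_j
    b∉ : b ∉ A j
    b∉ b∈ = δ∉ (subst (_∈ A j) (partner-quotient δ a)
                  (proj₁ (closed j) a b a∈ b∈ (δ≢e ∘ trans (sym (partner-quotient δ a)))))
    elsewhere : ∃[ i ] (b ∈ A i) → InOtherBlock j b
    elsewhere (i , b∈) = i , (λ { refl → b∉ b∈ }) , b∈

  N-own-block : ∀ j δ → δ ∈ A j → N G A j δ ≡ 0
  N-own-block j δ δ∈ = trans (N-by-partner j δ) (∑-zero _ λ a →
    pairInd-absent j δ a _ λ (a∈ , other , _) → partner-stays j δ a δ∈ a∈ other)

  N-other-block : ∀ j δ → δ ≢ e → δ ∉ A j → N G A j δ ≡ ∣ A j ∣
  N-other-block j δ δ≢e δ∉ = trans (N-by-partner j δ) (∑-indicator (A j) _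
    (λ a a∈ → pairInd-present j δ a _ a∈ (partner-leaves j δ a δ≢e δ∉ a∈) (partner-quotient δ a))
    (λ a a∉ → pairInd-absent j δ a _ λ (a∈ , _) → a∉ a∈))

mainTheorem15 : {n m : ℕ} (G : FinGroup n) (A : Fin m → Subset n)
    → PairwiseDisjoint G A
    → (∀ i → 0 < ∣ A i ∣)
    → (∀ i x → x ∈ A i → x ≢ FinGroup.e G)
    → (∀ x → x ≢ FinGroup.e G → ∃[ i ] (x ∈ A i))
    → (∀ i → 1 < ∣ A i ∣ → ∃[ S ] (IsSubgroup G S × A i ≡ S ∖ FinGroup.e G))
    → IsRWEDF G A (λ i → ∣ A i ∣) ((+ m) / 1 - 1ℚ) × Bimodal G A
mainTheorem15 {n} {m} G A disjoint nonempty avoid-e cover blocks =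
  (disjoint , (λ _ → refl) , nonempty , weighted-sum) , bimodal
  where
  open BlockCounts G A disjoint avoid-e cover (λ i → block⇒quotientClosed G (blocks i))

  bimodal : Bimodal G A
  bimodal δ δ≢e j with δ ∈? A j
  ... | yes δ∈ = inj₁ (N-own-block j δ δ∈)
  ... | no  δ∉ = inj₂ (N-other-block j δ δ≢e δ∉)

  -- δ's own block has weight 0, every other block weight 1.
  weighted-sum : ∀ (δ : Fin n) → δ ≢ FinGroup.e G
               → sumFinℚ (λ i → frac (N G A i δ) ∣ A i ∣) ≡ fromℕ m - 1ℚ
  weighted-sum δ δ≢e with cover δ δ≢e
  ... | j , δ∈ = sumFinℚ-ones-but-one _ j
    (trans (cong (λ k → frac k ∣ A j ∣) (N-own-block j δ δ∈)) (frac-zero ∣ A j ∣))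
    (λ i i≢j → trans (cong (λ k → frac k ∣ A i ∣)
                       (N-other-block i δ δ≢e (disjoint j i δ (i≢j ∘ sym) δ∈)))
                     (frac-self ∣ A i ∣ (nonempty i)))
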